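{- Let $G_1,\dots,G_n$ be finite simple graphs with initial vertex labels, and fix a number of iterations $h$. Let $\mathbf{K}\in\mathbb{R}^{n\times n}$ be the kernel matrix with entries $\mathbf{K}_{ab}=\sum_{i=0}^{h}\sum_{v\in V(G_a)}\sum_{v'\in V(G_b)}\delta\big(l_i(v),l_i(v')\big)$ given by the graph Weisfeiler-Lehman subtree kernel, and let $\mathbf{K}'\in\mathbb{R}^{n\times n}$ be the kernel matrix with entries $\mathbf{K}'_{ab}=\sum_{i=0}^{h}\sum_{v\in V(G_a)}\sum_{v'\in V(G_b)}\delta\big(l_i^v(v),l_i^v(v')\big)$ given by the hypergraph Weisfeiler-Lehman subtree kernel, where each $G_a$ is regarded as a hypergraph whose hyperedges are its edges (each of size 2), with the same initial vertex labels and all initial hyperedge labels equal. Then $\mathbf{K}=\mathbf{K}'$.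
   Context: $\delta(x,y)=1$ if $x=y$ and $0$ otherwise. A single injective compression function $f$ (strings to labels) is used for all graphs, and labels produced at different iterations are distinct; $\|$ is string concatenation, $\{\!\{\cdot\}\!\}$ a multiset, sort a fixed ordering. Graph Weisfeiler-Lehman labels: $l_0(v)$ is the initial label; for $i\ge1$, $l_i(v)=f\big(l_{i-1}(v)\,\|\,\mathrm{sort}\{\!\{l_{i-1}(u):u\in\mathcal{N}(v)\}\!\}\big)$, with $\mathcal{N}(v)$ the neighbours of $v$. Hypergraph Weisfeiler-Lehman labels: $l_0^v(v)$ is the initial vertex label and $l_0^e(e)$ the (common) initial hyperedge label; for $i\ge1$, first $l_i^e(e)=f\big(l_{i-1}^e(e)\,\|\,\mathrm{sort}\{\!\{l_{i-1}^v(u):u\in e\}\!\}\big)$ for every hyperedge $e$, then $l_i^v(v)=f\big(l_{i-1}^v(v)\,\|\,\mathrm{sort}\{\!\{l_i^e(e):e\ni v\}\!\}\big)$ for every vertex $v$. Equivalently, each kernel is the inner product of feature vectors counting occurrences of each label at each iteration $0,\dots,h$. -}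

module Defs where

open import Data.Nat using (ℕ; zero; suc; _<ᵇ_)
open import Data.Bool using (Bool; true; false; if_then_else_; _∧_)
open import Data.Fin using (Fin; toℕ)
open import Data.List using (List; []; _∷_; map; filterᵇ; concatMap; length; lookup; upTo; allFin)
open import Data.Nat.ListAction using (sum)
open import Data.Bool.ListAction using (any)
open import Data.Product using (_×_; _,_; proj₁; proj₂)
open import Relation.Binary.PropositionalEquality using (_≡_; _≢_)
open import Relation.Binary.Definitions using (DecidableEquality)
open import Relation.Nullary.Decidable using (⌊_⌋)
open import Data.List.Relation.Binary.Permutation.Propositional using (_↭_)

record LGraph (L : Set) : Set where
  field
    size   : ℕ
    adj    : Fin size → Fin size → Bool
    adj-sym    : ∀ u v → adj u v ≡ adj v u
    adj-irrefl : ∀ u → adj u u ≡ false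
    label₀ : Fin size → L

record LHypergraph (L : Set) : Set where
  field
    nV     : ℕ
    nE     : ℕ
    verts  : Fin nE → List (Fin nV)
    label₀ : Fin nV → L

-- A "sort by a fixed ordering": a canonical representative of a multiset.
record Sorter (L : Set) : Set where
  field
    sort       : List L → List L
    sort-perm  : ∀ xs → sort xs ↭ xs
    sort-canon : ∀ xs ys → xs ↭ ys → sort xs ≡ sort ys

δ : {L : Set} → DecidableEquality L → L → L → ℕ
δ _≟_ x y = if ⌊ x ≟ y ⌋ then 1 else 0

sumTo : ℕ → (ℕ → ℕ) → ℕ
sumTo h g = sum (map g (upTo (suc h)))

sumFin : (m : ℕ) → (Fin m → ℕ) → ℕ
sumFin m g = sum (map g (allFin m))

module WL {L : Set} (_≟_ : DecidableEquality L) (f : List L → L) (S : Sorter L) where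
  open Sorter S

  nbrs : (G : LGraph L) → Fin (LGraph.size G) → List (Fin (LGraph.size G))
  nbrs G v = filterᵇ (λ u → LGraph.adj G v u) (allFin (LGraph.size G))

  gwl : (G : LGraph L) → ℕ → Fin (LGraph.size G) → L
  gwl G zero    v = LGraph.label₀ G v
  gwl G (suc i) v = f (gwl G i v ∷ sort (map (gwl G i) (nbrs G v)))

  incident : (H : LHypergraph L) → Fin (LHypergraph.nV H) → List (Fin (LHypergraph.nE H))
  incident H v = filterᵇ (λ e → any (λ u → ⌊ u Data.Fin.≟ v ⌋) (LHypergraph.verts H e))
                         (allFin (LHypergraph.nE H))

  hwlE : (e₀ : L) (H : LHypergraph L) → ℕ → Fin (LHypergraph.nE H) → L
  hwlV : (e₀ : L) (H : LHypergraph L) → ℕ → Fin (LHypergraph.nV H) → L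
  hwlE e₀ H zero    e = e₀
  hwlE e₀ H (suc i) e = f (hwlE e₀ H i e ∷ sort (map (hwlV e₀ H i) (LHypergraph.verts H e)))
  hwlV e₀ H zero    v = LHypergraph.label₀ H v
  hwlV e₀ H (suc i) v = f (hwlV e₀ H i v ∷ sort (map (hwlE e₀ H (suc i)) (incident H v)))

edgeList : {L : Set} (G : LGraph L) → List (Fin (LGraph.size G) × Fin (LGraph.size G))
edgeList G = concatMap (λ u → map (u ,_)
                 (filterᵇ (λ w → (toℕ u <ᵇ toℕ w) ∧ LGraph.adj G u w) (allFin (LGraph.size G))))
               (allFin (LGraph.size G))

toHypergraph : {L : Set} → LGraph L → LHypergraph L
toHypergraph G = record
  { nV = LGraph.size G
  ; nE = length (edgeList G)
  ; verts = λ e → proj₁ (lookup (edgeList G) e) ∷ proj₂ (lookup (edgeList G) e) ∷ []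
  ; label₀ = LGraph.label₀ G
  }

module Kernels {L : Set} (_≟_ : DecidableEquality L) (f : List L → L) (S : Sorter L)
               (e₀ : L) {n : ℕ} (Gs : Fin n → LGraph L) (h : ℕ) where
  open WL _≟_ f S

  K : Fin n → Fin n → ℕ
  K a b = sumTo h λ i → sumFin (LGraph.size (Gs a)) λ v → sumFin (LGraph.size (Gs b)) λ v' →
            δ _≟_ (gwl (Gs a) i v) (gwl (Gs b) i v')

  K' : Fin n → Fin n → ℕ
  K' a b = sumTo h λ i → sumFin (LGraph.size (Gs a)) λ v → sumFin (LGraph.size (Gs b)) λ v' →
             δ _≟_ (hwlV e₀ (toHypergraph (Gs a)) i v) (hwlV e₀ (toHypergraph (Gs b)) i v')

  DistinctIterations : Set
  DistinctIterations =
    (∀ a b i j v v' → i ≢ j → gwl (Gs a) i v ≢ gwl (Gs b) j v') ×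
    (∀ a b i j v v' → i ≢ j →
       hwlV e₀ (toHypergraph (Gs a)) i v ≢ hwlV e₀ (toHypergraph (Gs b)) j v') ×
    (∀ a b i j e e' → i ≢ j →
       hwlE e₀ (toHypergraph (Gs a)) i e ≢ hwlE e₀ (toHypergraph (Gs b)) j e')

-- In G viewed as a hypergraph, the label of the hyperedge {u, w} after i + 1 rounds depends only,
-- and symmetrically, on the round-i vertex labels of u and w, and the hyperedges at v are exactly
-- the edges to the neighbours of v. Because f is injective, the graph label and the hypergraph
-- label of a vertex at round i therefore determine each other, across any two graphs: by
-- induction on i, l_i(v) = l_i(v') iff l^v_i(v) = l^v_i(v'). So every δ term of K equals the
-- corresponding term of K'.
module Submission where

open import Defs
open import Data.Nat using (ℕ; zero; suc; _<ᵇ_)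
open import Data.Nat.Properties using (<-cmp; <-asym; <⇒<ᵇ; <ᵇ⇒<)
open import Data.Bool using (Bool; true; false; if_then_else_; _∧_; _∨_; T; T?)
open import Data.Bool.Properties using (∨-identityʳ; ∧-zeroʳ; ∧-identityʳ; ∧-distribʳ-∨; T-≡; T-∧; T-∨)
open import Data.Fin using (Fin; zero; suc; toℕ; _≟_)
open import Data.Fin.Properties using (toℕ-injective)
open import Data.List
  using (List; []; _∷_; [_]; _++_; map; concatMap; filterᵇ; lookup; length; allFin; tabulate; upTo)
open import Data.List.Properties
  using (∷-injective; filter-++; filter-all; filter-none; map-++; map-∘; map-cong; map-concatMap; concatMap-cong;
         ++-assoc; ++-identityʳ; map-tabulate; tabulate-lookup)
open import Data.List.Relation.Unary.All using (universal)
open import Data.List.Relation.Binary.Permutation.Propositional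
  using (_↭_; prep; swap; ↭-refl; ↭-sym; ↭-trans; ↭-reflexive; module PermutationReasoning)
open import Data.List.Relation.Binary.Permutation.Propositional.Properties
  using (shift; shifts; ++⁺ˡ; map⁺; ↭-map-inv; drop-∷; ↭-singleton-inv)
open import Data.Nat.ListAction using (sum)
open import Data.Bool.ListAction using (any)
open import Data.Product using (_×_; _,_; proj₁; proj₂; uncurry)
open import Data.Sum using (inj₁; inj₂)
open import Function using (_∘_; _⇔_; mk⇔; Equivalence)
open import Function.Definitions using (Injective)
open import Relation.Binary.Definitions using (DecidableEquality; tri<; tri≈; tri>)
open import Relation.Binary.PropositionalEquality hiding ([_])
open import Relation.Nullary using (yes; no; contradiction)
open import Relation.Nullary.Decidable using (⌊_⌋; ⌊⌋-map′; isYes≗does; does-⇔)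

private variable
  A B C D : Set

filterᵇ-cong : {p q : A → Bool} → (∀ x → p x ≡ q x) → ∀ xs → filterᵇ p xs ≡ filterᵇ q xs
filterᵇ-cong p≗q [] = refl
filterᵇ-cong {p = p} {q} p≗q (x ∷ xs) with p x | q x | p≗q x
... | true  | true  | refl = cong (x ∷_) (filterᵇ-cong p≗q xs)
... | false | false | refl = filterᵇ-cong p≗q xs

filterᵇ-map : (p : B → Bool) (g : A → B) → ∀ xs → filterᵇ p (map g xs) ≡ map g (filterᵇ (p ∘ g) xs)
filterᵇ-map p g [] = refl
filterᵇ-map p g (x ∷ xs) with p (g x)
... | true  = cong (g x ∷_) (filterᵇ-map p g xs)
... | false = filterᵇ-map p g xs

filterᵇ-comm : (p q : A → Bool) → ∀ xs → filterᵇ p (filterᵇ q xs) ≡ filterᵇ q (filterᵇ p xs)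
filterᵇ-comm p q [] = refl
filterᵇ-comm p q (x ∷ xs) with q x in qx | p x in px
... | true  | true  rewrite qx | px = cong (x ∷_) (filterᵇ-comm p q xs)
... | true  | false rewrite px      = filterᵇ-comm p q xs
... | false | true  rewrite qx      = filterᵇ-comm p q xs
... | false | false                 = filterᵇ-comm p q xs

filterᵇ-concatMap : (p : B → Bool) (g : A → List B) → ∀ xs →
  filterᵇ p (concatMap g xs) ≡ concatMap (filterᵇ p ∘ g) xs
filterᵇ-concatMap p g [] = refl
filterᵇ-concatMap p g (x ∷ xs) =
  trans (filter-++ (T? ∘ p) (g x) (concatMap g xs)) (cong (filterᵇ p (g x) ++_) (filterᵇ-concatMap p g xs))

filterᵇ-∨-↭ : (p q : A → Bool) → (∀ x → p x ≡ true → q x ≡ false) → ∀ xs →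
  filterᵇ (λ x → p x ∨ q x) xs ↭ filterᵇ p xs ++ filterᵇ q xs
filterᵇ-∨-↭ p q disjoint [] = ↭-refl
filterᵇ-∨-↭ p q disjoint (x ∷ xs) with p x in px | q x in qx
... | true  | true  with () ← trans (sym (disjoint x px)) qx
... | true  | false = prep x (filterᵇ-∨-↭ p q disjoint xs)
... | false | true  =
  ↭-trans (prep x (filterᵇ-∨-↭ p q disjoint xs)) (↭-sym (shift x (filterᵇ p xs) (filterᵇ q xs)))
... | false | false = filterᵇ-∨-↭ p q disjoint xs

map-lookup-filterᵇ : (g : A → B) (p : A → Bool) (xs : List A) →
  map (g ∘ lookup xs) (filterᵇ (p ∘ lookup xs) (allFin (length xs))) ≡ map g (filterᵇ p xs)
map-lookup-filterᵇ g p xs = begin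
  map (g ∘ lookup xs) (filterᵇ (p ∘ lookup xs) (allFin (length xs)))
    ≡⟨ map-∘ _ ⟩
  map g (map (lookup xs) (filterᵇ (p ∘ lookup xs) (allFin (length xs))))
    ≡⟨ cong (map g) (filterᵇ-map p (lookup xs) (allFin (length xs))) ⟨
  map g (filterᵇ p (map (lookup xs) (allFin (length xs))))
    ≡⟨ cong (map g ∘ filterᵇ p) (trans (map-tabulate (λ i → i) (lookup xs)) (tabulate-lookup xs)) ⟩
  map g (filterᵇ p xs) ∎
  where open ≡-Reasoning

concatMap-guarded-singleton : (p : A → Bool) (g : A → B) → ∀ xs →
  concatMap (λ x → if p x then [ g x ] else []) xs ≡ map g (filterᵇ p xs)
concatMap-guarded-singleton p g [] = refl
concatMap-guarded-singleton p g (x ∷ xs) with p x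
... | true  = cong (g x ∷_) (concatMap-guarded-singleton p g xs)
... | false = concatMap-guarded-singleton p g xs

concatMap-guarded-const : (p : A → Bool) (ys : List B) → ∀ xs →
  concatMap (λ x → if p x then ys else []) xs ≡ concatMap (λ _ → ys) (filterᵇ p xs)
concatMap-guarded-const p ys [] = refl
concatMap-guarded-const p ys (x ∷ xs) with p x
... | true  = cong (ys ++_) (concatMap-guarded-const p ys xs)
... | false = concatMap-guarded-const p ys xs

concatMap-++-↭ : (g h : A → List B) → ∀ xs →
  concatMap (λ x → g x ++ h x) xs ↭ concatMap g xs ++ concatMap h xs
concatMap-++-↭ g h [] = ↭-refl
concatMap-++-↭ g h (x ∷ xs) = begin
  (g x ++ h x) ++ concatMap (λ y → g y ++ h y) xs  ↭⟨ ++⁺ˡ (g x ++ h x) (concatMap-++-↭ g h xs) ⟩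
  (g x ++ h x) ++ concatMap g xs ++ concatMap h xs ≡⟨ ++-assoc (g x) (h x) _ ⟩
  g x ++ h x ++ concatMap g xs ++ concatMap h xs   ↭⟨ ++⁺ˡ (g x) (shifts (h x) (concatMap g xs)) ⟩
  g x ++ concatMap g xs ++ h x ++ concatMap h xs   ≡⟨ ++-assoc (g x) (concatMap g xs) _ ⟨
  (g x ++ concatMap g xs) ++ h x ++ concatMap h xs ∎
  where open PermutationReasoning

map-≡-transfer : {k : A → C} {k' : B → C} (g : A → D) (g' : B → D) →
  (∀ x y → k x ≡ k' y → g x ≡ g' y) → ∀ xs ys → map k xs ≡ map k' ys → map g xs ≡ map g' ys
map-≡-transfer g g' det [] [] eq = refl
map-≡-transfer g g' det (x ∷ xs) (y ∷ ys) eq =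
  cong₂ _∷_ (det x y (proj₁ (∷-injective eq))) (map-≡-transfer g g' det xs ys (proj₂ (∷-injective eq)))

map-↭-transfer : {k : A → C} {k' : B → C} (g : A → D) (g' : B → D) →
  (∀ x y → k x ≡ k' y → g x ≡ g' y) → ∀ xs ys → map k xs ↭ map k' ys → map g xs ↭ map g' ys
map-↭-transfer {k' = k'} g g' det xs ys perm with ↭-map-inv k' (↭-sym perm)
... | ys' , kxs≡k'ys' , ys↭ys' =
  ↭-trans (↭-reflexive (map-≡-transfer g g' det xs ys' kxs≡k'ys')) (map⁺ g' (↭-sym ys↭ys'))

↭-pair-cancelˡ : {x x' y y' : A} → x ≡ x' → x ∷ y ∷ [] ↭ x' ∷ y' ∷ [] → y ≡ y'
↭-pair-cancelˡ refl perm with ↭-singleton-inv (drop-∷ perm)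
... | refl = refl

filterᵇ-tabulate-suc : ∀ {s} (p : Fin (suc s) → Bool) →
  filterᵇ p (tabulate suc) ≡ map suc (filterᵇ (p ∘ suc) (allFin s))
filterᵇ-tabulate-suc {s} p =
  trans (cong (filterᵇ p) (sym (map-tabulate (λ i → i) suc))) (filterᵇ-map p suc (allFin s))

filterᵇ-≟-allFin : ∀ {s} (v : Fin s) → filterᵇ (λ w → ⌊ w ≟ v ⌋) (allFin s) ≡ [ v ]
filterᵇ-≟-allFin {suc s} zero = cong (zero ∷_) (begin
  filterᵇ (λ w → ⌊ w ≟ zero ⌋) (tabulate suc)
    ≡⟨ filterᵇ-tabulate-suc (λ w → ⌊ w ≟ zero ⌋) ⟩
  map suc (filterᵇ (λ _ → false) (allFin s))
    ≡⟨ cong (map suc) (filter-none (T? ∘ λ _ → false) (universal (λ _ ()) (allFin s))) ⟩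
  [] ∎)
  where open ≡-Reasoning
filterᵇ-≟-allFin {suc s} (suc v) = begin
  filterᵇ (λ w → ⌊ w ≟ suc v ⌋) (tabulate suc)
    ≡⟨ filterᵇ-tabulate-suc (λ w → ⌊ w ≟ suc v ⌋) ⟩
  map suc (filterᵇ (λ w → ⌊ suc w ≟ suc v ⌋) (allFin s))
    ≡⟨ cong (map suc) (filterᵇ-cong (λ w → ⌊⌋-map′ _ _ (w ≟ v)) (allFin s)) ⟩
  map suc (filterᵇ (λ w → ⌊ w ≟ v ⌋) (allFin s))
    ≡⟨ cong (map suc) (filterᵇ-≟-allFin v) ⟩
  [ suc v ] ∎
  where open ≡-Reasoning

<ᵇ-connex : ∀ {m n} → m ≢ n → (m <ᵇ n) ∨ (n <ᵇ m) ≡ true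
<ᵇ-connex {m} {n} m≢n with <-cmp m n
... | tri< m<n _ _ = Equivalence.to T-≡ (Equivalence.from T-∨ (inj₁ (<⇒<ᵇ m<n)))
... | tri≈ _ m≡n _ = contradiction m≡n m≢n
... | tri> _ _ n<m = Equivalence.to T-≡ (Equivalence.from T-∨ (inj₂ (<⇒<ᵇ n<m)))

<ᵇ-asym : ∀ {m n} → T (m <ᵇ n) → (n <ᵇ m) ≡ false
<ᵇ-asym {m} {n} m<n with n <ᵇ m in n<m
... | false = refl
... | true  = contradiction (<ᵇ⇒< m n m<n) (<-asym (<ᵇ⇒< n m (Equivalence.from T-≡ n<m)))

δ-cong : {L : Set} (_≟ᴸ_ : DecidableEquality L) {x y x' y' : L} →
  (x ≡ y ⇔ x' ≡ y') → δ _≟ᴸ_ x y ≡ δ _≟ᴸ_ x' y'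
δ-cong _≟ᴸ_ {x} {y} {x'} {y'} x≡y⇔x'≡y' = cong (λ b → if b then 1 else 0)
  (trans (isYes≗does (x ≟ᴸ y)) (trans (does-⇔ x≡y⇔x'≡y' (x ≟ᴸ y) (x' ≟ᴸ y')) (sym (isYes≗does (x' ≟ᴸ y')))))

module EdgeIncidence {L : Set} (G : LGraph L) (v : Fin (LGraph.size G))
                     {X : Set} (Q : Fin (LGraph.size G) → Fin (LGraph.size G) → X)
                     (Q-sym : ∀ u w → Q u w ≡ Q w u) where
  open LGraph G

  vertices : List (Fin size)
  vertices = allFin size

  -- edgeList lists each edge once, as (u , w) with u < w; so the edges at v are the (v , w) with
  -- w an upper neighbour and the (u , v) with u a lower neighbour, and Q-sym reorients the latter.
  above : Fin size → Fin size → Bool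
  above u w = (toℕ u <ᵇ toℕ w) ∧ adj u w

  below : Fin size → Bool
  below u = (toℕ u <ᵇ toℕ v) ∧ adj v u

  touches : Fin size × Fin size → Bool
  touches e = any (λ u → ⌊ u ≟ v ⌋) (proj₁ e ∷ proj₂ e ∷ [])

  lower : Fin size → List X
  lower u = if below u then [ Q v u ] else []

  upper : List X
  upper = map (Q v) (filterᵇ (above v) vertices)

  adj-guarded : ∀ x → adj v x ≡ ((toℕ x <ᵇ toℕ v) ∨ (toℕ v <ᵇ toℕ x)) ∧ adj v x
  adj-guarded x with adj v x in vx
  ... | false = sym (∧-zeroʳ _)
  ... | true  = sym (trans (∧-identityʳ _) (<ᵇ-connex (λ x≡v → not-loop (toℕ-injective x≡v))))
    where
    not-loop : x ≢ v
    not-loop refl with () ← trans (sym vx) (adj-irrefl v)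

  adj-split : ∀ x → adj v x ≡ below x ∨ above v x
  adj-split x = trans (adj-guarded x) (∧-distribʳ-∨ (adj v x) (toℕ x <ᵇ toℕ v) (toℕ v <ᵇ toℕ x))

  below-above-disjoint : ∀ x → below x ≡ true → above v x ≡ false
  below-above-disjoint x bx
    rewrite <ᵇ-asym {toℕ x} {toℕ v} (proj₁ (Equivalence.to T-∧ (Equivalence.from T-≡ bx))) = refl

  neighbours-split : filterᵇ (adj v) vertices ↭ filterᵇ below vertices ++ filterᵇ (above v) vertices
  neighbours-split = ↭-trans (↭-reflexive (filterᵇ-cong adj-split vertices))
                             (filterᵇ-∨-↭ below (above v) below-above-disjoint vertices)

  labels-touching-above : ∀ u →
    map (Q u) (filterᵇ (λ w → touches (u , w)) (filterᵇ (above u) vertices))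
      ≡ lower u ++ (if ⌊ u ≟ v ⌋ then upper else [])
  labels-touching-above u with u ≟ v
  ... | yes refl rewrite adj-irrefl v | ∧-zeroʳ (toℕ v <ᵇ toℕ v) =
    cong (map (Q v)) (filter-all (T? ∘ λ _ → true) (universal _ (filterᵇ (above v) vertices)))
  ... | no u≢v = begin
    map (Q u) (filterᵇ (λ w → ⌊ w ≟ v ⌋ ∨ false) (filterᵇ (above u) vertices))
      ≡⟨ cong (map (Q u)) (filterᵇ-cong (λ w → ∨-identityʳ ⌊ w ≟ v ⌋) (filterᵇ (above u) vertices)) ⟩
    map (Q u) (filterᵇ (λ w → ⌊ w ≟ v ⌋) (filterᵇ (above u) vertices))
      ≡⟨ cong (map (Q u)) (filterᵇ-comm _ (above u) vertices) ⟩
    map (Q u) (filterᵇ (above u) (filterᵇ (λ w → ⌊ w ≟ v ⌋) vertices))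
      ≡⟨ cong (map (Q u) ∘ filterᵇ (above u)) (filterᵇ-≟-allFin v) ⟩
    map (Q u) (filterᵇ (above u) [ v ])
      ≡⟨ single-edge ⟩
    lower u ++ [] ∎
    where
    open ≡-Reasoning
    single-edge : map (Q u) (filterᵇ (above u) [ v ]) ≡ lower u ++ []
    single-edge rewrite adj-sym u v with below u
    ... | true  = cong [_] (Q-sym u v)
    ... | false = refl

  edges-from : Fin size → List (Fin size × Fin size)
  edges-from u = map (u ,_) (filterᵇ (above u) vertices)

  labels-touching-edges-from : ∀ u → map (uncurry Q) (filterᵇ touches (edges-from u))
                                      ≡ lower u ++ (if ⌊ u ≟ v ⌋ then upper else [])
  labels-touching-edges-from u = begin
    map (uncurry Q) (filterᵇ touches (map (u ,_) (filterᵇ (above u) vertices)))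
      ≡⟨ cong (map (uncurry Q)) (filterᵇ-map touches (u ,_) (filterᵇ (above u) vertices)) ⟩
    map (uncurry Q) (map (u ,_) (filterᵇ (λ w → touches (u , w)) (filterᵇ (above u) vertices)))
      ≡⟨ map-∘ _ ⟨
    map (Q u) (filterᵇ (λ w → touches (u , w)) (filterᵇ (above u) vertices))
      ≡⟨ labels-touching-above u ⟩
    lower u ++ (if ⌊ u ≟ v ⌋ then upper else []) ∎
    where open ≡-Reasoning

  concatMap-upper-at-v : concatMap (λ u → if ⌊ u ≟ v ⌋ then upper else []) vertices ≡ upper
  concatMap-upper-at-v = begin
    concatMap (λ u → if ⌊ u ≟ v ⌋ then upper else []) vertices
      ≡⟨ concatMap-guarded-const (λ u → ⌊ u ≟ v ⌋) upper vertices ⟩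
    concatMap (λ _ → upper) (filterᵇ (λ u → ⌊ u ≟ v ⌋) vertices)
      ≡⟨ cong (concatMap (λ _ → upper)) (filterᵇ-≟-allFin v) ⟩
    upper ++ []
      ≡⟨ ++-identityʳ upper ⟩
    upper ∎
    where open ≡-Reasoning

  touching-edge-labels : map (uncurry Q) (filterᵇ touches (edgeList G)) ↭ map (Q v) (filterᵇ (adj v) vertices)
  touching-edge-labels = begin
    map (uncurry Q) (filterᵇ touches (concatMap edges-from vertices))
      ≡⟨ cong (map (uncurry Q)) (filterᵇ-concatMap touches edges-from vertices) ⟩
    map (uncurry Q) (concatMap (filterᵇ touches ∘ edges-from) vertices)
      ≡⟨ map-concatMap (uncurry Q) (filterᵇ touches ∘ edges-from) vertices ⟩
    concatMap (map (uncurry Q) ∘ filterᵇ touches ∘ edges-from) vertices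
      ≡⟨ concatMap-cong labels-touching-edges-from vertices ⟩
    concatMap (λ u → lower u ++ (if ⌊ u ≟ v ⌋ then upper else [])) vertices
      ↭⟨ concatMap-++-↭ lower (λ u → if ⌊ u ≟ v ⌋ then upper else []) vertices ⟩
    concatMap lower vertices ++ concatMap (λ u → if ⌊ u ≟ v ⌋ then upper else []) vertices
      ≡⟨ cong₂ _++_ (concatMap-guarded-singleton below (Q v) vertices) concatMap-upper-at-v ⟩
    map (Q v) (filterᵇ below vertices) ++ upper
      ≡⟨ map-++ (Q v) (filterᵇ below vertices) (filterᵇ (above v) vertices) ⟨
    map (Q v) (filterᵇ below vertices ++ filterᵇ (above v) vertices)
      ↭⟨ map⁺ (Q v) (↭-sym neighbours-split) ⟩
    map (Q v) (filterᵇ (adj v) vertices) ∎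
    where open PermutationReasoning

module HypergraphWL {L : Set} (_≟ᴸ_ : DecidableEquality L) (f : List L → L)
                    (f-injective : Injective _≡_ _≡_ f) (S : Sorter L) (e₀ : L) where
  open WL _≟ᴸ_ f S
  open Sorter S

  hlabel : (G : LGraph L) → ℕ → Fin (LGraph.size G) → L
  hlabel G = hwlV e₀ (toHypergraph G)

  edgeLabel : (G : LGraph L) → ℕ → (u w : Fin (LGraph.size G)) → L
  edgeLabel G zero    u w = e₀
  edgeLabel G (suc i) u w = f (edgeLabel G i u w ∷ sort (hlabel G i u ∷ hlabel G i w ∷ []))

  hwlE-toHypergraph : ∀ G i e → hwlE e₀ (toHypergraph G) i e ≡ uncurry (edgeLabel G i) (lookup (edgeList G) e)
  hwlE-toHypergraph G zero    e = refl
  hwlE-toHypergraph G (suc i) e =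
    cong (λ l → f (l ∷ sort (map (hlabel G i) (LHypergraph.verts (toHypergraph G) e))))
         (hwlE-toHypergraph G i e)

  edgeLabel-sym : ∀ G i u w → edgeLabel G i u w ≡ edgeLabel G i w u
  edgeLabel-sym G zero    u w = refl
  edgeLabel-sym G (suc i) u w =
    cong₂ (λ l ls → f (l ∷ ls)) (edgeLabel-sym G i u w) (sort-canon _ _ (swap _ _ ↭-refl))

  relabel-injective : ∀ {x y xs ys} → f (x ∷ sort xs) ≡ f (y ∷ sort ys) → x ≡ y × xs ↭ ys
  relabel-injective {xs = xs} {ys} eq with ∷-injective (f-injective eq)
  ... | x≡y , sxs≡sys =
    x≡y , ↭-trans (↭-sym (sort-perm xs)) (↭-trans (↭-reflexive sxs≡sys) (sort-perm ys))

  hlabel-≡-pred : ∀ G G' i {u u'} → hlabel G (suc i) u ≡ hlabel G' (suc i) u' → hlabel G i u ≡ hlabel G' i u'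
  hlabel-≡-pred G G' i eq = proj₁ (∷-injective (f-injective eq))

  edgeLabel-cong : ∀ G G' i {u w u' w'} → hlabel G i u ≡ hlabel G' i u' → hlabel G i w ≡ hlabel G' i w' →
    edgeLabel G (suc i) u w ≡ edgeLabel G' (suc i) u' w'
  edgeLabel-cong G G' zero    eu ew = cong (λ ls → f (e₀ ∷ sort ls)) (cong₂ (λ a b → a ∷ b ∷ []) eu ew)
  edgeLabel-cong G G' (suc i) eu ew =
    cong₂ (λ l ls → f (l ∷ sort ls))
          (edgeLabel-cong G G' i (hlabel-≡-pred G G' i eu) (hlabel-≡-pred G G' i ew))
          (cong₂ (λ a b → a ∷ b ∷ []) eu ew)

  incident-edge-labels : ∀ G i v →
    map (hwlE e₀ (toHypergraph G) i) (incident (toHypergraph G) v) ↭ map (edgeLabel G i v) (nbrs G v)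
  incident-edge-labels G i v = ↭-trans
    (↭-reflexive (trans (map-cong (hwlE-toHypergraph G i) _)
                        (map-lookup-filterᵇ (uncurry (edgeLabel G i)) touches (edgeList G))))
    touching-edge-labels
    where open EdgeIncidence G v (edgeLabel G i) (edgeLabel-sym G i)

  gwl-≡⇔hlabel-≡ : ∀ i G G' v v' → gwl G i v ≡ gwl G' i v' ⇔ hlabel G i v ≡ hlabel G' i v'
  gwl-≡⇔hlabel-≡ zero    G G' v v' = mk⇔ (λ eq → eq) (λ eq → eq)
  gwl-≡⇔hlabel-≡ (suc i) G G' v v' = mk⇔ forward backward
    where
    IH : ∀ u u' → gwl G i u ≡ gwl G' i u' ⇔ hlabel G i u ≡ hlabel G' i u'
    IH = gwl-≡⇔hlabel-≡ i G G'

    incident↭⇔nbrs-edges↭ :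
      (map (hwlE e₀ (toHypergraph G) (suc i)) (incident (toHypergraph G) v)
        ↭ map (hwlE e₀ (toHypergraph G') (suc i)) (incident (toHypergraph G') v'))
      ⇔ (map (edgeLabel G (suc i) v) (nbrs G v) ↭ map (edgeLabel G' (suc i) v') (nbrs G' v'))
    incident↭⇔nbrs-edges↭ = mk⇔
      (λ p → ↭-trans (↭-sym (incident-edge-labels G (suc i) v))
                     (↭-trans p (incident-edge-labels G' (suc i) v')))
      (λ p → ↭-trans (incident-edge-labels G (suc i) v)
                     (↭-trans p (↭-sym (incident-edge-labels G' (suc i) v'))))

    forward : gwl G (suc i) v ≡ gwl G' (suc i) v' → hlabel G (suc i) v ≡ hlabel G' (suc i) v'
    forward eq with relabel-injective eq
    ... | gv≡gv' , nbrs↭ = cong₂ (λ l ls → f (l ∷ ls)) hv≡hv'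
      (sort-canon _ _ (Equivalence.from incident↭⇔nbrs-edges↭
        (map-↭-transfer (edgeLabel G (suc i) v) (edgeLabel G' (suc i) v')
          (λ u u' gu≡gu' → edgeLabel-cong G G' i hv≡hv' (Equivalence.to (IH u u') gu≡gu'))
          (nbrs G v) (nbrs G' v') nbrs↭)))
      where
      hv≡hv' : hlabel G i v ≡ hlabel G' i v'
      hv≡hv' = Equivalence.to (IH v v') gv≡gv'

    backward : hlabel G (suc i) v ≡ hlabel G' (suc i) v' → gwl G (suc i) v ≡ gwl G' (suc i) v'
    backward eq with relabel-injective eq
    ... | hv≡hv' , incident↭ = cong₂ (λ l ls → f (l ∷ ls)) (Equivalence.from (IH v v') hv≡hv')
      (sort-canon _ _ (map-↭-transfer (gwl G i) (gwl G' i) edge-determines-nbr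
        (nbrs G v) (nbrs G' v') (Equivalence.to incident↭⇔nbrs-edges↭ incident↭)))
      where
      edge-determines-nbr : ∀ u u' → edgeLabel G (suc i) v u ≡ edgeLabel G' (suc i) v' u' →
                            gwl G i u ≡ gwl G' i u'
      edge-determines-nbr u u' eu with relabel-injective eu
      ... | _ , ends↭ = Equivalence.from (IH u u') (↭-pair-cancelˡ hv≡hv' ends↭)

-- The kernels only compare labels of equal iterations.
theorem2 : {L : Set} (_≟_ : DecidableEquality L) (f : List L → L) → Injective _≡_ _≡_ f →
    (S : Sorter L) (e₀ : L) (n : ℕ) (Gs : Fin n → LGraph L) (h : ℕ) →
    Kernels.DistinctIterations _≟_ f S e₀ Gs h →
    ∀ a b → Kernels.K _≟_ f S e₀ Gs h a b ≡ Kernels.K' _≟_ f S e₀ Gs h a b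
theorem2 _≟ᴸ_ f f-injective S e₀ n Gs h _ a b =
  cong sum (map-cong (λ i →
    cong sum (map-cong (λ v →
      cong sum (map-cong (λ v' →
        δ-cong _≟ᴸ_ (gwl-≡⇔hlabel-≡ i (Gs a) (Gs b) v v'))
      (allFin _)))
    (allFin _)))
  (upTo (suc h)))
  where open HypergraphWL _≟ᴸ_ f f-injective S e₀
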